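{- Let $\Sigma=(B,K,E,\mathrm{ar},\mathrm{car})$ be a $\lambda_c$-signature and $Y$ a fixed object with associated new base type $b^Y$. If $\Gamma\vdash M\colon\mathbf{t}$ is a well-typed term over $\Sigma$, then $\mathrm{SPS}(\Gamma)\vdash\mathrm{SPS}(M)\colon\mathrm{SPS}(\mathbf{t})$ is a well-typed term over the signature $\mathrm{SPS}(\Sigma)$.
   Context: Syntax: given base types $B$, types are $\mathbf{t}::=b\mid\mathbf{1}\mid\mathbf{t}_1\times\mathbf{t}_2\mid\mathbf{0}\mid\mathbf{t}_1+\mathbf{t}_2\mid\mathbf{t}_1\to\mathbf{t}_2$; ground types are those without $\to$. A $\lambda_c$-signature $\Sigma=(B,K,E,\mathrm{ar},\mathrm{car})$ has effect-free constants $K$, generic effects $E$, and $\mathrm{ar},\mathrm{car}\colon K+E\to$ ground types. Terms: $M,N::=x\mid c\,M\mid e\,M\mid()\mid(M,N)\mid\pi_iM\mid\delta(M)\mid\iota_iM\mid\delta(M,x_1\colon\mathbf{t}_1.N_1,x_2\colon\mathbf{t}_2.N_2)\mid\lambda x\colon\mathbf{t}.M\mid M\,N$, typed by the standard simply-typed rules (with $c\,M\colon\mathrm{car}(c)$ for $M\colon\mathrm{ar}(c)$, $e\,M\colon\mathrm{car}(e)$ for $M\colon\mathrm{ar}(e)$, $\delta(M)\colon\mathbf{t}$ for $M\colon\mathbf{0}$). SPS transformation. Add a base type $b^Y$ ($B$ becomes $B+\{b^Y\}$). Types: $\mathbf{t}^\circ=\mathbf{t}$ for $\mathbf{t}\in\{b,\mathbf{1},\mathbf{0}\}$,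 $(\mathbf{t}_1\times\mathbf{t}_2)^\circ=\mathbf{t}_1^\circ\times\mathbf{t}_2^\circ$, $(\mathbf{t}_1+\mathbf{t}_2)^\circ=\mathbf{t}_1^\circ+\mathbf{t}_2^\circ$, $(\mathbf{t}_1\to\mathbf{t}_2)^\circ=(\mathbf{t}_1^\circ\times b^Y)\to(\mathbf{t}_2^\circ\times b^Y)$, and $\mathrm{SPS}(\mathbf{t})=\mathbf{t}^\circ\times b^Y$. For $\Gamma=x_1\colon\mathbf{t}_1,\dots,x_m\colon\mathbf{t}_m$, $\mathrm{SPS}(\Gamma)=x_1\colon\mathbf{t}_1^\circ,\dots,x_m\colon\mathbf{t}_m^\circ,y\colon b^Y$ with $y$ a distinguished variable. The signature $\mathrm{SPS}(\Sigma)=(B+\{b^Y\},K,E,\mathrm{ar}',\mathrm{car}')$ with $\mathrm{ar}'(k)=\mathrm{ar}(k)\times b^Y$, $\mathrm{car}'(k)=\mathrm{car}(k)\times b^Y$ for $k\in K+E$. Terms ($z$ fresh): $\mathrm{SPS}(x)=(x,y)$; $\mathrm{SPS}(c\,M)=c\,\mathrm{SPS}(M)$; $\mathrm{SPS}(e\,M)=e\,\mathrm{SPS}(M)$; $\mathrm{SPS}(())=((),y)$; $\mathrm{SPS}((M,N))=(\lambda z.((\pi_1z,\pi_1\pi_2z),\pi_2\pi_2z))\,((\lambda z.(\pi_1z,(\lambda y.\mathrm{SPS}(N))(\pi_2z)))\,\mathrm{SPS}(M))$; $\mathrm{SPS}(\pi_iM)=(\lambda z.(\pi_i\pi_1z,\pi_2z))\,\mathrm{SPS}(M)$;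 $\mathrm{SPS}(\delta(M))=(\lambda z.(\delta(\pi_1z),\pi_2z))\,\mathrm{SPS}(M)$; $\mathrm{SPS}(\iota_iM)=(\lambda z.(\iota_i\pi_1z,\pi_2z))\,\mathrm{SPS}(M)$; $\mathrm{SPS}(\delta(M,x_1\colon\mathbf{t}_1.M_1,x_2\colon\mathbf{t}_2.M_2))=\delta(N,z\colon\mathrm{SPS}(\mathbf{t}_1).\mathrm{SPS}(M_1)[\pi_1z/x_1,\pi_2z/y],z\colon\mathrm{SPS}(\mathbf{t}_2).\mathrm{SPS}(M_2)[\pi_1z/x_2,\pi_2z/y])$ where $N=(\lambda z.\delta(\pi_1z,x_1\colon\mathbf{t}_1^\circ.\iota_1(x_1,\pi_2z),x_2\colon\mathbf{t}_2^\circ.\iota_2(x_2,\pi_2z)))\,\mathrm{SPS}(M)$; $\mathrm{SPS}(\lambda x\colon\mathbf{t}_1.M)=(\lambda z\colon\mathrm{SPS}(\mathbf{t}_1).\mathrm{SPS}(M)[\pi_1z/x,\pi_2z/y],\,y)$; $\mathrm{SPS}(M\,N)=(\lambda z.(\pi_1z)((\lambda y.\mathrm{SPS}(N))(\pi_2z)))\,\mathrm{SPS}(M)$. -}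

module Defs where

open import Data.Nat using (ℕ; zero; suc)
open import Data.List using (List; []; _∷_; map)
open import Data.Sum using (_⊎_; inj₁; inj₂)
open import Data.Unit using (⊤; tt)

infixr 7 _⊗_
infixr 6 _⊕_
infixr 5 _⇒_

data Ty (B : Set) : Set where
  base : B → Ty B
  𝟙    : Ty B
  _⊗_  : Ty B → Ty B → Ty B
  𝟘    : Ty B
  _⊕_  : Ty B → Ty B → Ty B
  _⇒_  : Ty B → Ty B → Ty B

data Ground {B : Set} : Ty B → Set where
  g-base : ∀ b → Ground (base b)
  g-𝟙    : Ground 𝟙
  g-⊗    : ∀ {s t} → Ground s → Ground t → Ground (s ⊗ t)
  g-𝟘    : Ground 𝟘
  g-⊕    : ∀ {s t} → Ground s → Ground t → Ground (s ⊕ t)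

record Sig : Set₁ where
  field
    B K E      : Set
    ar car     : K ⊎ E → Ty B
    ar-ground  : ∀ k → Ground (ar k)
    car-ground : ∀ k → Ground (car k)

data Tm (K E B : Set) : Set where
  var   : ℕ → Tm K E B
  con   : K → Tm K E B → Tm K E B
  eff   : E → Tm K E B → Tm K E B
  unit  : Tm K E B
  pair  : Tm K E B → Tm K E B → Tm K E B
  π₁ π₂ : Tm K E B → Tm K E B
  absurd : Tm K E B → Tm K E B
  ι₁ ι₂ : Tm K E B → Tm K E B
  case  : Tm K E B → Ty B → Tm K E B → Ty B → Tm K E B → Tm K E B
        -- δ(M, x₁:t₁.N₁, x₂:t₂.N₂), x_i bound as index 0 in N_i
  lam   : Ty B → Tm K E B → Tm K E B
  app   : Tm K E B → Tm K E B → Tm K E B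

Ctx : Set → Set
Ctx B = List (Ty B)

data _∋_∶_ {B : Set} : Ctx B → ℕ → Ty B → Set where
  here  : ∀ {Γ t} → (t ∷ Γ) ∋ zero ∶ t
  there : ∀ {Γ s t n} → Γ ∋ n ∶ t → (s ∷ Γ) ∋ suc n ∶ t

infix 3 _∶_⊢_∶_

data _∶_⊢_∶_ (S : Sig) : Ctx (Sig.B S) → Tm (Sig.K S) (Sig.E S) (Sig.B S)
                        → Ty (Sig.B S) → Set where
  ⊢var  : ∀ {Γ n t} → Γ ∋ n ∶ t → S ∶ Γ ⊢ var n ∶ t
  ⊢con  : ∀ {Γ M} k → S ∶ Γ ⊢ M ∶ Sig.ar S (inj₁ k)
        → S ∶ Γ ⊢ con k M ∶ Sig.car S (inj₁ k)
  ⊢eff  : ∀ {Γ M} e → S ∶ Γ ⊢ M ∶ Sig.ar S (inj₂ e)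
        → S ∶ Γ ⊢ eff e M ∶ Sig.car S (inj₂ e)
  ⊢unit : ∀ {Γ} → S ∶ Γ ⊢ unit ∶ 𝟙
  ⊢pair : ∀ {Γ M N s t} → S ∶ Γ ⊢ M ∶ s → S ∶ Γ ⊢ N ∶ t
        → S ∶ Γ ⊢ pair M N ∶ s ⊗ t
  ⊢π₁   : ∀ {Γ M s t} → S ∶ Γ ⊢ M ∶ s ⊗ t → S ∶ Γ ⊢ π₁ M ∶ s
  ⊢π₂   : ∀ {Γ M s t} → S ∶ Γ ⊢ M ∶ s ⊗ t → S ∶ Γ ⊢ π₂ M ∶ t
  ⊢absurd : ∀ {Γ M t} → S ∶ Γ ⊢ M ∶ 𝟘 → S ∶ Γ ⊢ absurd M ∶ t
  ⊢ι₁   : ∀ {Γ M s t} → S ∶ Γ ⊢ M ∶ s → S ∶ Γ ⊢ ι₁ M ∶ s ⊕ t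
  ⊢ι₂   : ∀ {Γ M s t} → S ∶ Γ ⊢ M ∶ t → S ∶ Γ ⊢ ι₂ M ∶ s ⊕ t
  ⊢case : ∀ {Γ M N₁ N₂ t₁ t₂ t} → S ∶ Γ ⊢ M ∶ t₁ ⊕ t₂
        → S ∶ (t₁ ∷ Γ) ⊢ N₁ ∶ t → S ∶ (t₂ ∷ Γ) ⊢ N₂ ∶ t
        → S ∶ Γ ⊢ case M t₁ N₁ t₂ N₂ ∶ t
  ⊢lam  : ∀ {Γ M s t} → S ∶ (s ∷ Γ) ⊢ M ∶ t → S ∶ Γ ⊢ lam s M ∶ s ⇒ t
  ⊢app  : ∀ {Γ M N s t} → S ∶ Γ ⊢ M ∶ s ⇒ t → S ∶ Γ ⊢ N ∶ s
        → S ∶ Γ ⊢ app M N ∶ t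

ext : (ℕ → ℕ) → ℕ → ℕ
ext ρ zero    = zero
ext ρ (suc n) = suc (ρ n)

ren : ∀ {K E B} → (ℕ → ℕ) → Tm K E B → Tm K E B
ren ρ (var n)   = var (ρ n)
ren ρ (con k M) = con k (ren ρ M)
ren ρ (eff e M) = eff e (ren ρ M)
ren ρ unit      = unit
ren ρ (pair M N) = pair (ren ρ M) (ren ρ N)
ren ρ (π₁ M)    = π₁ (ren ρ M)
ren ρ (π₂ M)    = π₂ (ren ρ M)
ren ρ (absurd M) = absurd (ren ρ M)
ren ρ (ι₁ M)    = ι₁ (ren ρ M)
ren ρ (ι₂ M)    = ι₂ (ren ρ M)
ren ρ (case M s N₁ t N₂) = case (ren ρ M) s (ren (ext ρ) N₁) t (ren (ext ρ) N₂)
ren ρ (lam s M) = lam s (ren (ext ρ) M)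
ren ρ (app M N) = app (ren ρ M) (ren ρ N)

exts : ∀ {K E B} → (ℕ → Tm K E B) → ℕ → Tm K E B
exts σ zero    = var zero
exts σ (suc n) = ren suc (σ n)

sub : ∀ {K E B} → (ℕ → Tm K E B) → Tm K E B → Tm K E B
sub σ (var n)   = σ n
sub σ (con k M) = con k (sub σ M)
sub σ (eff e M) = eff e (sub σ M)
sub σ unit      = unit
sub σ (pair M N) = pair (sub σ M) (sub σ N)
sub σ (π₁ M)    = π₁ (sub σ M)
sub σ (π₂ M)    = π₂ (sub σ M)
sub σ (absurd M) = absurd (sub σ M)
sub σ (ι₁ M)    = ι₁ (sub σ M)
sub σ (ι₂ M)    = ι₂ (sub σ M)
sub σ (case M s N₁ t N₂) = case (sub σ M) s (sub (exts σ) N₁) t (sub (exts σ) N₂)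
sub σ (lam s M) = lam s (sub (exts σ) M)
sub σ (app M N) = app (sub σ M) (sub σ N)

-- B ↦ B + {b^Y}
bY : ∀ {B} → Ty (B ⊎ ⊤)
bY = base (inj₂ tt)

_° : ∀ {B} → Ty B → Ty (B ⊎ ⊤)
base b ° = base (inj₁ b)
𝟙 ° = 𝟙
(s ⊗ t) ° = s ° ⊗ t °
𝟘 ° = 𝟘
(s ⊕ t) ° = s ° ⊕ t °
(s ⇒ t) ° = (s ° ⊗ bY) ⇒ (t ° ⊗ bY)

SPSᵗ : ∀ {B} → Ty B → Ty (B ⊎ ⊤)
SPSᵗ t = t ° ⊗ bY

-- SPS(x₁:t₁,…,xₘ:tₘ) = x₁:t₁°,…,xₘ:tₘ°, y:b^Y ; y is the innermost variable (index 0)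
SPSᶜ : ∀ {B} → Ctx B → Ctx (B ⊎ ⊤)
SPSᶜ Γ = bY ∷ map _° Γ

°-ground : ∀ {B} {t : Ty B} → Ground t → Ground (t °)
°-ground (g-base b) = g-base (inj₁ b)
°-ground g-𝟙 = g-𝟙
°-ground (g-⊗ g h) = g-⊗ (°-ground g) (°-ground h)
°-ground g-𝟘 = g-𝟘
°-ground (g-⊕ g h) = g-⊕ (°-ground g) (°-ground h)

-- SPS(Σ) = (B + {b^Y}, K, E, ar', car'),  ar'(k) = ar(k) × b^Y, car'(k) = car(k) × b^Y
-- (ar(k) viewed over B + {b^Y}; on ground types this inclusion is _°)
SPSˢ : Sig → Sig
SPSˢ S = record
  { B = Sig.B S ⊎ ⊤
  ; K = Sig.K S
  ; E = Sig.E S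
  ; ar  = λ k → Sig.ar S k ° ⊗ bY
  ; car = λ k → Sig.car S k ° ⊗ bY
  ; ar-ground  = λ k → g-⊗ (°-ground (Sig.ar-ground S k)) (g-base (inj₂ tt))
  ; car-ground = λ k → g-⊗ (°-ground (Sig.car-ground S k)) (g-base (inj₂ tt))
  }

-- context  y ∷ Γ°  seen from inside  λz.λy.(-) :  y ∷ z ∷ y_old ∷ Γ°
-- (the body SPS(N) refers only to the new y and to Γ)
ρ-under-zy : ℕ → ℕ
ρ-under-zy zero    = zero
ρ-under-zy (suc n) = suc (suc (suc n))

-- [π₁z/x, π₂z/y] : from context  y ∷ x ∷ Γ°  to  z ∷ y_old ∷ Γ°
σ-split : ∀ {K E B} → ℕ → Tm K E B
σ-split zero          = π₂ (var zero)
σ-split (suc zero)    = π₁ (var zero)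
σ-split (suc (suc n)) = var (suc (suc n))

-- SPS(M), defined on well-typed terms (the types of the fresh binders z are
-- read off the typing derivation); result lives in context SPS(Γ).
SPS : ∀ {S Γ M t} → S ∶ Γ ⊢ M ∶ t → Tm (Sig.K S) (Sig.E S) (Sig.B S ⊎ ⊤)
SPS (⊢var {n = n} _) = pair (var (suc n)) (var zero)
SPS (⊢con k d) = con k (SPS d)
SPS (⊢eff e d) = eff e (SPS d)
SPS ⊢unit = pair unit (var zero)
SPS (⊢pair {s = s} {t = t} dM dN) =
  app (lam (s ° ⊗ (t ° ⊗ bY))
           (pair (pair (π₁ (var 0)) (π₁ (π₂ (var 0)))) (π₂ (π₂ (var 0)))))
      (app (lam (SPSᵗ s)
                (pair (π₁ (var 0)) (app (lam bY (ren ρ-under-zy (SPS dN))) (π₂ (var 0)))))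
           (SPS dM))
SPS (⊢π₁ {s = s} {t = t} d) =
  app (lam (SPSᵗ (s ⊗ t)) (pair (π₁ (π₁ (var 0))) (π₂ (var 0)))) (SPS d)
SPS (⊢π₂ {s = s} {t = t} d) =
  app (lam (SPSᵗ (s ⊗ t)) (pair (π₂ (π₁ (var 0))) (π₂ (var 0)))) (SPS d)
SPS (⊢absurd d) =
  app (lam (SPSᵗ 𝟘) (pair (absurd (π₁ (var 0))) (π₂ (var 0)))) (SPS d)
SPS (⊢ι₁ {s = s} d) =
  app (lam (SPSᵗ s) (pair (ι₁ (π₁ (var 0))) (π₂ (var 0)))) (SPS d)
SPS (⊢ι₂ {t = t} d) =
  app (lam (SPSᵗ t) (pair (ι₂ (π₁ (var 0))) (π₂ (var 0)))) (SPS d)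
SPS (⊢case {t₁ = t₁} {t₂ = t₂} dM d₁ d₂) =
  case (app (lam (SPSᵗ (t₁ ⊕ t₂))
                 (case (π₁ (var 0))
                       (t₁ °) (ι₁ (pair (var 0) (π₂ (var 1))))
                       (t₂ °) (ι₂ (pair (var 0) (π₂ (var 1))))))
            (SPS dM))
       (SPSᵗ t₁) (sub σ-split (SPS d₁))
       (SPSᵗ t₂) (sub σ-split (SPS d₂))
SPS (⊢lam {s = s} d) = pair (lam (SPSᵗ s) (sub σ-split (SPS d))) (var zero)
SPS (⊢app {s = s} {t = t} dM dN) =
  app (lam (SPSᵗ (s ⇒ t))
           (app (π₁ (var 0)) (app (lam bY (ren ρ-under-zy (SPS dN))) (π₂ (var 0)))))
      (SPS dM)

-- The only non-syntactic steps
-- are weakening SPS(N) under the two binders λz.λy, and the substitution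
-- [π₁z/x, π₂z/y] below a binder of type SPS(t); both are instances of the facts
-- that renaming and substitution preserve typing.
module Submission where

open import Defs
open import Data.Nat using (ℕ; zero; suc)
open import Data.List using (_∷_; map)

module _ {B : Set} where

  Renaming : Ctx B → Ctx B → (ℕ → ℕ) → Set
  Renaming Γ Δ ρ = ∀ {n t} → Γ ∋ n ∶ t → Δ ∋ ρ n ∶ t

  ext-Renaming : ∀ {Γ Δ ρ s} → Renaming Γ Δ ρ → Renaming (s ∷ Γ) (s ∷ Δ) (ext ρ)
  ext-Renaming r here      = here
  ext-Renaming r (there x) = there (r x)

  under-zy-Renaming : ∀ {Δ c u} → Renaming (c ∷ Δ) (c ∷ u ∷ c ∷ Δ) ρ-under-zy
  under-zy-Renaming here      = here
  under-zy-Renaming (there x) = there (there (there x))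

module _ {S : Sig} where

  ⊢ren : ∀ {Γ Δ ρ M t} → Renaming Γ Δ ρ → S ∶ Γ ⊢ M ∶ t → S ∶ Δ ⊢ ren ρ M ∶ t
  ⊢ren r (⊢var x)         = ⊢var (r x)
  ⊢ren r (⊢con k d)       = ⊢con k (⊢ren r d)
  ⊢ren r (⊢eff e d)       = ⊢eff e (⊢ren r d)
  ⊢ren r ⊢unit            = ⊢unit
  ⊢ren r (⊢pair d₁ d₂)    = ⊢pair (⊢ren r d₁) (⊢ren r d₂)
  ⊢ren r (⊢π₁ d)          = ⊢π₁ (⊢ren r d)
  ⊢ren r (⊢π₂ d)          = ⊢π₂ (⊢ren r d)
  ⊢ren r (⊢absurd d)      = ⊢absurd (⊢ren r d)
  ⊢ren r (⊢ι₁ d)          = ⊢ι₁ (⊢ren r d)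
  ⊢ren r (⊢ι₂ d)          = ⊢ι₂ (⊢ren r d)
  ⊢ren r (⊢case d d₁ d₂)  =
    ⊢case (⊢ren r d) (⊢ren (ext-Renaming r) d₁) (⊢ren (ext-Renaming r) d₂)
  ⊢ren r (⊢lam d)         = ⊢lam (⊢ren (ext-Renaming r) d)
  ⊢ren r (⊢app d₁ d₂)     = ⊢app (⊢ren r d₁) (⊢ren r d₂)

  Substitution : Ctx (Sig.B S) → Ctx (Sig.B S)
               → (ℕ → Tm (Sig.K S) (Sig.E S) (Sig.B S)) → Set
  Substitution Γ Δ σ = ∀ {n t} → Γ ∋ n ∶ t → S ∶ Δ ⊢ σ n ∶ t

  exts-Substitution : ∀ {Γ Δ σ s} → Substitution Γ Δ σ
                    → Substitution (s ∷ Γ) (s ∷ Δ) (exts σ)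
  exts-Substitution r here      = ⊢var here
  exts-Substitution r (there x) = ⊢ren there (r x)

  ⊢sub : ∀ {Γ Δ σ M t} → Substitution Γ Δ σ → S ∶ Γ ⊢ M ∶ t → S ∶ Δ ⊢ sub σ M ∶ t
  ⊢sub r (⊢var x)         = r x
  ⊢sub r (⊢con k d)       = ⊢con k (⊢sub r d)
  ⊢sub r (⊢eff e d)       = ⊢eff e (⊢sub r d)
  ⊢sub r ⊢unit            = ⊢unit
  ⊢sub r (⊢pair d₁ d₂)    = ⊢pair (⊢sub r d₁) (⊢sub r d₂)
  ⊢sub r (⊢π₁ d)          = ⊢π₁ (⊢sub r d)
  ⊢sub r (⊢π₂ d)          = ⊢π₂ (⊢sub r d)
  ⊢sub r (⊢absurd d)      = ⊢absurd (⊢sub r d)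
  ⊢sub r (⊢ι₁ d)          = ⊢ι₁ (⊢sub r d)
  ⊢sub r (⊢ι₂ d)          = ⊢ι₂ (⊢sub r d)
  ⊢sub r (⊢case d d₁ d₂)  =
    ⊢case (⊢sub r d) (⊢sub (exts-Substitution r) d₁) (⊢sub (exts-Substitution r) d₂)
  ⊢sub r (⊢lam d)         = ⊢lam (⊢sub (exts-Substitution r) d)
  ⊢sub r (⊢app d₁ d₂)     = ⊢app (⊢sub r d₁) (⊢sub r d₂)

  split-Substitution : ∀ {Δ a c u} → Substitution (c ∷ a ∷ Δ) (a ⊗ c ∷ u ∷ Δ) σ-split
  split-Substitution here              = ⊢π₂ (⊢var here)
  split-Substitution (there here)      = ⊢π₁ (⊢var here)
  split-Substitution (there (there x)) = ⊢var (there (there x))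

  ⊢mapProj₁ : ∀ {Γ M a b c}
              (F : Tm (Sig.K S) (Sig.E S) (Sig.B S) → Tm (Sig.K S) (Sig.E S) (Sig.B S))
            → (∀ {Δ N} → S ∶ Δ ⊢ N ∶ a → S ∶ Δ ⊢ F N ∶ b)
            → S ∶ Γ ⊢ M ∶ a ⊗ c
            → S ∶ Γ ⊢ app (lam (a ⊗ c) (pair (F (π₁ (var 0))) (π₂ (var 0)))) M ∶ b ⊗ c
  ⊢mapProj₁ F ⊢F d = ⊢app (⊢lam (⊢pair (⊢F (⊢π₁ (⊢var here))) (⊢π₂ (⊢var here)))) d

∋-° : ∀ {B : Set} {Γ : Ctx B} {n t} → Γ ∋ n ∶ t → map _° Γ ∋ n ∶ (t °)
∋-° here      = here
∋-° (there x) = there (∋-° x)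

⊢resumeWithState : ∀ {S Γ N a T}
                 → SPSˢ S ∶ SPSᶜ Γ ⊢ N ∶ T
                 → SPSˢ S ∶ a ⊗ bY ∷ SPSᶜ Γ ⊢ app (lam bY (ren ρ-under-zy N)) (π₂ (var 0)) ∶ T
⊢resumeWithState d = ⊢app (⊢lam (⊢ren under-zy-Renaming d)) (⊢π₂ (⊢var here))

⊢split : ∀ {S Γ s N T}
       → SPSˢ S ∶ SPSᶜ (s ∷ Γ) ⊢ N ∶ T
       → SPSˢ S ∶ SPSᵗ s ∷ SPSᶜ Γ ⊢ sub σ-split N ∶ T
⊢split = ⊢sub split-Substitution

lemma5p2 : (S : Sig) {Γ : Ctx (Sig.B S)} {M : Tm (Sig.K S) (Sig.E S) (Sig.B S)}
           {t : Ty (Sig.B S)} (d : S ∶ Γ ⊢ M ∶ t)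
           → SPSˢ S ∶ SPSᶜ Γ ⊢ SPS d ∶ SPSᵗ t
lemma5p2 S (⊢var x)    = ⊢pair (⊢var (there (∋-° x))) (⊢var here)
lemma5p2 S (⊢con k d)  = ⊢con k (lemma5p2 S d)
lemma5p2 S (⊢eff e d)  = ⊢eff e (lemma5p2 S d)
lemma5p2 S ⊢unit       = ⊢pair ⊢unit (⊢var here)
lemma5p2 S (⊢pair dM dN) =
  ⊢app (⊢lam (⊢pair (⊢pair (⊢π₁ (⊢var here)) (⊢π₁ (⊢π₂ (⊢var here))))
                    (⊢π₂ (⊢π₂ (⊢var here)))))
       (⊢app (⊢lam (⊢pair (⊢π₁ (⊢var here)) (⊢resumeWithState (lemma5p2 S dN))))
             (lemma5p2 S dM))
lemma5p2 S (⊢π₁ d)     = ⊢mapProj₁ π₁ ⊢π₁ (lemma5p2 S d)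
lemma5p2 S (⊢π₂ d)     = ⊢mapProj₁ π₂ ⊢π₂ (lemma5p2 S d)
lemma5p2 S (⊢absurd d) = ⊢mapProj₁ absurd ⊢absurd (lemma5p2 S d)
lemma5p2 S (⊢ι₁ d)     = ⊢mapProj₁ ι₁ ⊢ι₁ (lemma5p2 S d)
lemma5p2 S (⊢ι₂ d)     = ⊢mapProj₁ ι₂ ⊢ι₂ (lemma5p2 S d)
lemma5p2 S (⊢case dM d₁ d₂) =
  ⊢case (⊢app (⊢lam (⊢case (⊢π₁ (⊢var here)) (⊢ι₁ (⊢pair (⊢var here) state))
                                             (⊢ι₂ (⊢pair (⊢var here) state))))
              (lemma5p2 S dM))
        (⊢split (lemma5p2 S d₁)) (⊢split (lemma5p2 S d₂))
  where
  state : ∀ {Δ a b} → SPSˢ S ∶ a ∷ b ⊗ bY ∷ Δ ⊢ π₂ (var 1) ∶ bY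
  state = ⊢π₂ (⊢var (there here))
lemma5p2 S (⊢lam d)    = ⊢pair (⊢lam (⊢split (lemma5p2 S d))) (⊢var here)
lemma5p2 S (⊢app dM dN) =
  ⊢app (⊢lam (⊢app (⊢π₁ (⊢var here)) (⊢resumeWithState (lemma5p2 S dN)))) (lemma5p2 S dM)
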